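{- If $G$ is a graph, then $b_{\rm g}(G) \le \min_{k \ge 1}\{2\gamma_k(G)+k-1\}$ and $b_{\rm g}'(G) \le \min_{k\ge 1}\{2\gamma_k(G)+k\}$.
   Context: For $k\ge1$, a set $S\subseteq V(G)$ is a distance $k$-dominating set if every vertex of $G$ is within distance $k$ of some vertex of $S$; $\gamma_k(G)$ is the minimum size of such a set. The burning game on a finite simple graph $G$ is played by two players, Burner and Staller. Each vertex is either burned or unburned, and once burned it stays burned. In round 1 the starting player chooses one unburned vertex and burns it (selection phase only). Each round $t \ge 2$ consists of a spreading phase, in which every unburned vertex with a burned neighbor becomes burned, followed, if unburned vertices remain, by a selection phase in which the player whose turn it is burns one unburned vertex; the two players make the selections alternately. The game ends in the first round in which all vertices are burned (this may happen right after a spreading phase), and its length is the number of that round. Burner wants to minimize the length and Staller to maximize it. $b_{\rm g}(G)$ is the length under optimal play when Burner makes the first selection, and $b_{\rm g}'(G)$ is the length under optimal play when Staller makes the first selection. -}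

module Defs where

open import Data.Nat using (ℕ; zero; suc; _⊓_; _⊔_)
open import Data.Bool using (Bool; true; false; not; _∧_; _∨_; if_then_else_)
open import Data.Fin using (Fin)
open import Data.Fin.Subset using (Subset; _∈_; ∣_∣; _∪_; ⁅_⁆) renaming (⊥ to ∅)
open import Data.Vec using (lookup; tabulate)
open import Data.List using (List; []; _∷_; map; foldr; filterᵇ; allFin)
open import Data.Bool.ListAction using (any; all)
open import Data.Product using (∃; _×_)
open import Relation.Binary.PropositionalEquality using (_≡_)

record Graph : Set where
  field
    n      : ℕ
    adj    : Fin n → Fin n → Bool
    adj-sym    : ∀ u v → adj u v ≡ adj v u
    adj-irrefl : ∀ u → adj u u ≡ false

module _ (G : Graph) where
  open Graph G

  -- WithinDist k u v : there is a walk from u to v with at most k edges,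
  -- i.e. d(u,v) ≤ k.
  data WithinDist : ℕ → Fin n → Fin n → Set where
    here : ∀ {k u} → WithinDist k u u
    step : ∀ {k u w v} → adj u w ≡ true → WithinDist k w v → WithinDist (suc k) u v

  IsDistDom : ℕ → Subset n → Set
  IsDistDom k S = ∀ v → ∃ λ u → u ∈ S × WithinDist k u v

  IsGamma : ℕ → ℕ → Set
  IsGamma k g = (∃ λ S → IsDistDom k S × ∣ S ∣ ≡ g)
              × (∀ S → IsDistDom k S → g Data.Nat.≤ ∣ S ∣)

  data Player : Set where
    burner staller : Player

  other : Player → Player
  other burner  = staller
  other staller = burner

  allBurned : Subset n → Bool
  allBurned B = all (λ v → lookup B v) (allFin n)

  unburned : Subset n → List (Fin n)
  unburned B = filterᵇ (λ v → not (lookup B v)) (allFin n)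

  spread : Subset n → Subset n
  spread B = tabulate λ v → lookup B v ∨ any (λ u → adj u v ∧ lookup B u) (allFin n)

  minL : List ℕ → ℕ
  minL []       = 0
  minL (x ∷ xs) = foldr _⊓_ x xs

  maxL : List ℕ → ℕ
  maxL = foldr _⊔_ 0

  combine : Player → List ℕ → ℕ
  combine burner  = minL
  combine staller = maxL

  -- value f p B : with burned set B (not all burned), at the selection phase
  -- of some round t with player p to select, the number of further rounds
  -- (beyond t) under optimal play.  f is fuel; it suffices that f is at least
  -- the number of unburned vertices, since each selection burns a new vertex.
  value : ℕ → Player → Subset n → ℕ
  value zero    p B = 0
  value (suc f) p B = combine p (map (λ v → after (B ∪ ⁅ v ⁆)) (unburned B))
    where
    after : Subset n → ℕ
    after B′ = if allBurned B′ then 0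
               else (if allBurned (spread B′) then 1
                     else suc (value f (other p) (spread B′)))

  gameLength : Player → ℕ
  gameLength p = suc (value n p ∅)

  bg : ℕ
  bg = gameLength burner

  bg′ : ℕ
  bg′ = gameLength staller

module Submission where

-- Burner burns, as long as there is one, an unburned centre of a distance-k dominating
-- set S with |S| = g; Staller's selections only help. Centres then get burned within
-- 2g − 1 selections (2g if Staller starts), and a centre burned when R rounds remain
-- has its ball of radius k − R burned, since every spreading phase enlarges it by one.
-- As every vertex is within distance k of a centre, all is burned k rounds after the
-- last centre. The induction invariant is these balls together with the bound
-- roundsNeeded p (number of unburned centres) ≤ R on the remaining rounds R.

open import Defs
open import Data.Nat using (ℕ; zero; suc; _≤_; _<_; _+_; _*_; _∸_; _⊓_; z≤n; s≤s)
open import Data.Nat.Properties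
  using (≤-refl; ≤-trans; ≤-reflexive; ≤-pred; 1+n≰n; m≤n+m; n≤1+n; +-suc; +-identityʳ; +-monoˡ-≤; *-monoʳ-≤; *-suc;
         m⊓n≤m; m⊓n≤n; ⊔-lub)
open import Data.Bool using (true; false; not; _∧_; _∨_; if_then_else_; T)
open import Data.Bool.Properties using (T-≡; T-∨; T-∧)
open import Data.Bool.ListAction using (any)
open import Data.Fin using (Fin; fromℕ<)
open import Data.Fin.Subset using (Subset; _∈_; _∉_; _⊆_; Empty; ∣_∣; _∪_; _∩_; ∁; ⁅_⁆) renaming (⊥ to ∅)
open import Data.Fin.Subset.Properties
  using (_∈?_; nonempty?; ∉⊥; x∈⁅x⁆; x∈⁅y⁆⇒x≡y; Empty-unique; ∣⊥∣≡0; p⊆p∪q; q⊆p∪q; x∈p∪q⁻; x∈p∩q⁺; x∈p∩q⁻; x∈∁p⇒x∉p; x∉p⇒x∈∁p;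
         p⊆q⇒∣p∣≤∣q∣; p⊂q⇒∣p∣<∣q∣; x∈p⇒∣p-x∣<∣p∣; ∣p∩q∣≤∣p∣)
open import Data.Vec using (lookup; tabulate)
open import Data.Vec.Properties using (lookup∘tabulate; []=⇒lookup; lookup⇒[]=)
open import Data.List using ([]; _∷_; map; foldr; allFin)
open import Data.List.Membership.Propositional using (lose) renaming (_∈_ to _∈ₗ_)
open import Data.List.Membership.Propositional.Properties using (∈-filter⁺; ∈-filter⁻; ∈-allFin; ∈-map⁺)
open import Data.List.Relation.Unary.Any using (here; there)
open import Data.List.Relation.Unary.Any.Properties using (any⁺)
open import Data.Product using (∃; _×_; _,_; proj₁; proj₂)
open import Data.Sum using (_⊎_; inj₁; inj₂)
open import Data.Unit using (tt)
open import Function using (_∘_)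
open import Function.Bundles using (Equivalence)
open import Relation.Nullary using (yes; no; contradiction)
open import Relation.Nullary.Decidable using (T?)
open import Relation.Binary.PropositionalEquality using (_≡_; refl; sym; trans; cong; subst)

open Equivalence using (to; from)

foldr-⊓-≤-seed : ∀ z ys → foldr _⊓_ z ys ≤ z
foldr-⊓-≤-seed z []       = ≤-refl
foldr-⊓-≤-seed z (y ∷ ys) = ≤-trans (m⊓n≤n y _) (foldr-⊓-≤-seed z ys)

foldr-⊓-≤-∈ : ∀ z {y ys} → y ∈ₗ ys → foldr _⊓_ z ys ≤ y
foldr-⊓-≤-∈ z {ys = y ∷ ys} (here refl) = m⊓n≤m y _
foldr-⊓-≤-∈ z {ys = y ∷ ys} (there y∈) = ≤-trans (m⊓n≤n y _) (foldr-⊓-≤-∈ z y∈)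

∣Empty∣≡0 : ∀ {n} {C : Subset n} → Empty C → ∣ C ∣ ≡ 0
∣Empty∣≡0 {n} none = trans (cong ∣_∣ (Empty-unique none)) (∣⊥∣≡0 n)

∈⇒∣∣-positive : ∀ {n} {C : Subset n} {x} → x ∈ C → 0 < ∣ C ∣
∈⇒∣∣-positive x∈C = ≤-trans (s≤s z≤n) (x∈p⇒∣p-x∣<∣p∣ x∈C)

module _ (G : Graph) where
  open Graph G

  minL-map-≤ : ∀ {A : Set} (g : A → ℕ) {x xs} → x ∈ₗ xs → minL G (map g xs) ≤ g x
  minL-map-≤ g {xs = y ∷ ys} (here refl) = foldr-⊓-≤-seed (g y) (map g ys)
  minL-map-≤ g {xs = y ∷ ys} (there x∈)  = foldr-⊓-≤-∈ (g y) (∈-map⁺ g x∈)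

  maxL-map-≤ : ∀ {A : Set} (g : A → ℕ) xs {R} → (∀ {x} → x ∈ₗ xs → g x ≤ R) → maxL G (map g xs) ≤ R
  maxL-map-≤ g []       bound = z≤n
  maxL-map-≤ g (x ∷ xs) bound = ⊔-lub (bound (here refl)) (maxL-map-≤ g xs (bound ∘ there))

  combine-map-≤ : ∀ p {A : Set} {g : A → ℕ} xs {R} → (∀ {x} → x ∈ₗ xs → g x ≤ R) → combine G p (map g xs) ≤ R
  combine-map-≤ burner          []       bound = z≤n
  combine-map-≤ burner {g = g} (x ∷ xs) bound = ≤-trans (minL-map-≤ g {xs = x ∷ xs} (here refl)) (bound (here refl))
  combine-map-≤ staller         xs       bound = maxL-map-≤ _ xs bound

  T-lookup⇒∈ : ∀ {B : Subset n} {v} → T (lookup B v) → v ∈ B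
  T-lookup⇒∈ {B} {v} t = lookup⇒[]= v B (to (T-≡ {lookup B v}) t)

  ∈⇒T-lookup : ∀ {B : Subset n} {v} → v ∈ B → T (lookup B v)
  ∈⇒T-lookup {B} {v} v∈B = from (T-≡ {lookup B v}) ([]=⇒lookup v∈B)

  ∈-spread : ∀ {B v} → T (lookup B v ∨ any (λ u → adj u v ∧ lookup B u) (allFin n)) → v ∈ spread G B
  ∈-spread {B} {v} =
    T-lookup⇒∈ ∘ subst T (sym (lookup∘tabulate (λ w → lookup B w ∨ any (λ u → adj u w ∧ lookup B u) (allFin n)) v))

  ⊆-spread : ∀ {B} → B ⊆ spread G B
  ⊆-spread {B} {v} v∈B = ∈-spread {B} (from (T-∨ {lookup B v}) (inj₁ (∈⇒T-lookup v∈B)))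

  ∈-spread-adj : ∀ {B u v} → adj u v ≡ true → u ∈ B → v ∈ spread G B
  ∈-spread-adj {B} {u} {v} uv u∈B =
    ∈-spread {B} (from (T-∨ {lookup B v}) (inj₂ (any⁺ _ (lose (∈-allFin u) (from (T-∧ {adj u v}) (from T-≡ uv , ∈⇒T-lookup u∈B))))))

  ∈-unburned⁺ : ∀ {B v} → v ∉ B → v ∈ₗ unburned G B
  ∈-unburned⁺ {B} {v} v∉B = ∈-filter⁺ (T? ∘ not ∘ lookup B) (∈-allFin v) (T-not v∉B)
    where
    T-not : v ∉ B → T (not (lookup B v))
    T-not v∉B with lookup B v in eq
    ... | true  = v∉B (lookup⇒[]= v B eq)
    ... | false = tt

  ∈-unburned⁻ : ∀ {B v} → v ∈ₗ unburned G B → v ∉ B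
  ∈-unburned⁻ {B} v∈ v∈B =
    subst (T ∘ not) ([]=⇒lookup v∈B) (proj₂ (∈-filter⁻ (T? ∘ not ∘ lookup B) {xs = allFin n} v∈))

  -- The right-hand side is the local function after of value, applied to B′.
  selection-≤ : ∀ f p B′ {R} → value G f (other G p) (spread G B′) ≤ R →
                (if allBurned G B′ then 0
                 else (if allBurned G (spread G B′) then 1 else suc (value G f (other G p) (spread G B′))))
                ≤ suc R
  selection-≤ f p B′ le with allBurned G B′ | allBurned G (spread G B′)
  ... | true  | _     = z≤n
  ... | false | true  = s≤s z≤n
  ... | false | false = s≤s le

  withinDist-zero : ∀ {s w} → WithinDist G 0 s w → w ≡ s
  withinDist-zero here = refl

  withinDist-last : ∀ {j s w} → WithinDist G (suc j) s w →
                    WithinDist G j s w ⊎ ∃ λ x → WithinDist G j s x × adj x w ≡ true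
  withinDist-last here = inj₁ here
  withinDist-last {zero} (step a d) rewrite withinDist-zero d = inj₂ (_ , here , a)
  withinDist-last {suc j} (step a d) with withinDist-last d
  ... | inj₁ d′            = inj₁ (step a d′)
  ... | inj₂ (x , d′ , a′) = inj₂ (x , step a d′ , a′)

module Strategy (G : Graph) (k : ℕ) (k≥1 : 1 ≤ k) (S : Subset (Graph.n G)) (S-dom : IsDistDom G k S) where
  open Graph G

  -- The ball of radius k − R about s, written without truncated subtraction.
  BurnedAround : Subset n → Fin n → ℕ → Set
  BurnedAround B s R = ∀ {j w} → WithinDist G j s w → j + R ≤ k → w ∈ B

  burnedAround-mono : ∀ {B B′ s R} → B ⊆ B′ → BurnedAround B s R → BurnedAround B′ s R
  burnedAround-mono B⊆B′ ball d le = B⊆B′ (ball d le)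

  burnedAround-centre : ∀ {B s R} → s ∈ B → k ≤ R → BurnedAround B s R
  burnedAround-centre s∈B k≤R {zero}  d le rewrite withinDist-zero G d = s∈B
  burnedAround-centre {R = R} s∈B k≤R {suc j} d le =
    contradiction (≤-trans (s≤s (m≤n+m R j)) (≤-trans le k≤R)) 1+n≰n

  burnedAround-spread : ∀ {B s R} → s ∈ B → BurnedAround B s (suc R) → BurnedAround (spread G B) s R
  burnedAround-spread s∈B ball {zero} d le rewrite withinDist-zero G d = ⊆-spread G s∈B
  burnedAround-spread {R = R} s∈B ball {suc j} d le with withinDist-last G d
  ... | inj₁ d′           = ⊆-spread G (ball d′ (subst (_≤ k) (sym (+-suc j R)) le))
  ... | inj₂ (x , d′ , a) = ∈-spread-adj G a (ball d′ (subst (_≤ k) (sym (+-suc j R)) le))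

  unburnedCentres : Subset n → Subset n
  unburnedCentres B = S ∩ ∁ B

  ∈-unburnedCentres⁺ : ∀ {B s} → s ∈ S → s ∉ B → s ∈ unburnedCentres B
  ∈-unburnedCentres⁺ s∈S s∉B = x∈p∩q⁺ (s∈S , x∉p⇒x∈∁p s∉B)

  ∈-unburnedCentres⁻ : ∀ {B s} → s ∈ unburnedCentres B → s ∈ S × s ∉ B
  ∈-unburnedCentres⁻ {B} s∈ = let (s∈S , s∈∁B) = x∈p∩q⁻ S (∁ B) s∈ in s∈S , x∈∁p⇒x∉p s∈∁B

  unburnedCentres-antitone : ∀ {B B′} → B ⊆ B′ → unburnedCentres B′ ⊆ unburnedCentres B
  unburnedCentres-antitone B⊆B′ s∈ =
    let (s∈S , s∉B′) = ∈-unburnedCentres⁻ s∈ in ∈-unburnedCentres⁺ s∈S (s∉B′ ∘ B⊆B′)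

  burning-centre-shrinks : ∀ {B x} → x ∈ unburnedCentres B → ∣ unburnedCentres (B ∪ ⁅ x ⁆) ∣ < ∣ unburnedCentres B ∣
  burning-centre-shrinks {B} {x} x∈ = p⊂q⇒∣p∣<∣q∣
    ( unburnedCentres-antitone (p⊆p∪q _)
    , x , x∈ , λ x∈′ → proj₂ (∈-unburnedCentres⁻ x∈′) (q⊆p∪q B ⁅ x ⁆ (x∈⁅x⁆ x)))

  -- Enough further rounds when p is to select and m centres are unburned: Burner burns
  -- one centre in every two selections, and k spreading phases after the last one
  -- burn all k-balls around the centres.
  roundsNeeded : Player G → ℕ → ℕ
  roundsNeeded _       zero    = 0
  roundsNeeded burner  (suc m) = 2 * m + k
  roundsNeeded staller (suc m) = suc (2 * m + k)

  k≤roundsNeeded : ∀ p {m} → 0 < m → k ≤ roundsNeeded p m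
  k≤roundsNeeded burner  {suc m} _ = m≤n+m k (2 * m)
  k≤roundsNeeded staller {suc m} _ = ≤-trans (m≤n+m k (2 * m)) (n≤1+n _)

  roundsNeeded-mono : ∀ p {m m′} → m ≤ m′ → roundsNeeded p m ≤ roundsNeeded p m′
  roundsNeeded-mono p       {zero}           _       = z≤n
  roundsNeeded-mono burner  {suc m} {suc m′} m≤m′ = +-monoˡ-≤ k (*-monoʳ-≤ 2 (≤-pred m≤m′))
  roundsNeeded-mono staller {suc m} {suc m′} m≤m′ = s≤s (+-monoˡ-≤ k (*-monoʳ-≤ 2 (≤-pred m≤m′)))

  roundsNeeded-after-staller : ∀ {m R} → roundsNeeded staller m ≤ suc R → roundsNeeded burner m ≤ R
  roundsNeeded-after-staller {zero}  _  = z≤n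
  roundsNeeded-after-staller {suc m} le = ≤-pred le

  roundsNeeded-after-burner : ∀ {m R} → roundsNeeded burner (suc m) ≤ suc R → roundsNeeded staller m ≤ R
  roundsNeeded-after-burner {zero}  _  = z≤n
  roundsNeeded-after-burner {suc m} {R} le = ≤-pred (subst (_≤ suc R) (cong (_+ k) (*-suc 2 m)) le)

  record Invariant (p : Player G) (B : Subset n) (R : ℕ) : Set where
    field
      burnedAround-centres : ∀ {s} → s ∈ S → s ∈ B → BurnedAround B s R
      enough-rounds        : roundsNeeded p ∣ unburnedCentres B ∣ ≤ R
  open Invariant

  k≤rounds : ∀ {p B R s} → Invariant p B R → s ∈ unburnedCentres B → k ≤ R
  k≤rounds {p} inv s∈ = ≤-trans (k≤roundsNeeded p (∈⇒∣∣-positive s∈)) (enough-rounds inv)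

  all-burned : ∀ {p B} → Invariant p B 0 → ∀ w → w ∈ B
  all-burned {B = B} inv w with S-dom w
  ... | u , u∈S , d with u ∈? B
  ...   | yes u∈B = burnedAround-centres inv u∈S u∈B d (≤-reflexive (+-identityʳ k))
  ...   | no  u∉B = contradiction (≤-trans k≥1 (k≤rounds inv (∈-unburnedCentres⁺ u∈S u∉B))) λ ()

  invariant-step : ∀ {p p′ B v R} m → Invariant p B (suc R) → v ∉ B →
                   ∣ unburnedCentres (B ∪ ⁅ v ⁆) ∣ ≤ m → roundsNeeded p′ m ≤ R →
                   Invariant p′ (spread G (B ∪ ⁅ v ⁆)) R
  invariant-step {_} {p′} {B} {v} {R} m inv v∉B ∣U∣≤m enough = record
    { burnedAround-centres = centres
    ; enough-rounds        = ≤-trans (roundsNeeded-mono p′ ∣U′∣≤m) enough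
    }
    where
    B′ : Subset n
    B′ = B ∪ ⁅ v ⁆
    ∣U′∣≤m : ∣ unburnedCentres (spread G B′) ∣ ≤ m
    ∣U′∣≤m = ≤-trans (p⊆q⇒∣p∣≤∣q∣ (unburnedCentres-antitone {B′} (⊆-spread G))) ∣U∣≤m
    centres : ∀ {s} → s ∈ S → s ∈ spread G B′ → BurnedAround (spread G B′) s R
    centres {s} s∈S s∈spread with s ∈? B′
    ... | no s∉B′ =
      let s∈U′ = ∈-unburnedCentres⁺ s∈S s∉B′
      in burnedAround-centre s∈spread
           (≤-trans (k≤roundsNeeded p′ (≤-trans (∈⇒∣∣-positive s∈U′) ∣U∣≤m)) enough)
    ... | yes s∈B′ with x∈p∪q⁻ B ⁅ v ⁆ s∈B′
    ...   | inj₁ s∈B  = burnedAround-spread s∈B′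
                          (burnedAround-mono {B} (p⊆p∪q ⁅ v ⁆) (burnedAround-centres inv s∈S s∈B))
    ...   | inj₂ s∈⁅v⁆ rewrite x∈⁅y⁆⇒x≡y v s∈⁅v⁆ =
      burnedAround-spread s∈B′ (burnedAround-centre s∈B′ (k≤rounds inv (∈-unburnedCentres⁺ s∈S v∉B)))

  staller-step : ∀ {B v R} → Invariant staller B (suc R) → v ∉ B →
                 Invariant burner (spread G (B ∪ ⁅ v ⁆)) R
  staller-step {B} {v} inv v∉B =
    invariant-step ∣ unburnedCentres B ∣ inv v∉B
      (p⊆q⇒∣p∣≤∣q∣ (unburnedCentres-antitone {B} (p⊆p∪q ⁅ v ⁆)))
      (roundsNeeded-after-staller {∣ unburnedCentres B ∣} (enough-rounds inv))

  burner-centre-step : ∀ {B x R} → Invariant burner B (suc R) → x ∈ unburnedCentres B →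
                       Invariant staller (spread G (B ∪ ⁅ x ⁆)) R
  burner-centre-step {B} {x} inv x∈ =
    invariant-step ∣ unburnedCentres (B ∪ ⁅ x ⁆) ∣ inv (proj₂ (∈-unburnedCentres⁻ x∈)) ≤-refl
      (roundsNeeded-after-burner {∣ unburnedCentres (B ∪ ⁅ x ⁆) ∣}
        (≤-trans (roundsNeeded-mono burner (burning-centre-shrinks {B} x∈)) (enough-rounds inv)))

  burner-any-step : ∀ {B v R} → Invariant burner B (suc R) → Empty (unburnedCentres B) → v ∉ B →
                    Invariant staller (spread G (B ∪ ⁅ v ⁆)) R
  burner-any-step {B} {v} inv none v∉B =
    invariant-step 0 inv v∉B
      (≤-reflexive (∣Empty∣≡0 λ (x , x∈) → none (x , unburnedCentres-antitone {B} (p⊆p∪q ⁅ v ⁆) x∈)))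
      z≤n

  value-≤ : ∀ f p {B R} → Invariant p B R → value G f p B ≤ R
  value-≤ zero    p inv = z≤n
  value-≤ (suc f) p {B} {zero} inv =
    combine-map-≤ G p (unburned G B) λ v∈ → contradiction (all-burned inv _) (∈-unburned⁻ G v∈)
  value-≤ (suc f) staller {B} {suc R} inv =
    combine-map-≤ G staller (unburned G B) λ {v} v∈ →
      selection-≤ G f staller (B ∪ ⁅ v ⁆) (value-≤ f burner (staller-step inv (∈-unburned⁻ G v∈)))
  value-≤ (suc f) burner {B} {suc R} inv with nonempty? (unburnedCentres B)
  ... | yes (x , x∈) =
    ≤-trans (minL-map-≤ G _ (∈-unburned⁺ G (proj₂ (∈-unburnedCentres⁻ x∈))))
            (selection-≤ G f burner (B ∪ ⁅ x ⁆) (value-≤ f staller (burner-centre-step inv x∈)))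
  ... | no none =
    combine-map-≤ G burner (unburned G B) λ {v} v∈ →
      selection-≤ G f burner (B ∪ ⁅ v ⁆) (value-≤ f staller (burner-any-step inv none (∈-unburned⁻ G v∈)))

  gameLength-≤ : ∀ p → gameLength G p ≤ suc (roundsNeeded p ∣ S ∣)
  gameLength-≤ p = s≤s (value-≤ n p initial)
    where
    initial : Invariant p ∅ (roundsNeeded p ∣ S ∣)
    initial = record
      { burnedAround-centres = λ _ s∈∅ → contradiction s∈∅ ∉⊥
      ; enough-rounds        = roundsNeeded-mono p (∣p∩q∣≤∣p∣ S (∁ ∅))
      }

  suc-roundsNeeded-burner : ∀ {m} → 0 < m → suc (roundsNeeded burner m) ≡ 2 * m + k ∸ 1
  suc-roundsNeeded-burner {suc m} _ = cong (λ t → t + k ∸ 1) (sym (*-suc 2 m))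

  suc-roundsNeeded-staller : ∀ {m} → 0 < m → suc (roundsNeeded staller m) ≡ 2 * m + k
  suc-roundsNeeded-staller {suc m} _ = cong (_+ k) (sym (*-suc 2 m))

proposition3p4 : (G : Graph) → 1 ≤ Graph.n G →
    ∀ k g → 1 ≤ k → IsGamma G k g →
      (bg G ≤ 2 * g + k ∸ 1) × (bg′ G ≤ 2 * g + k)
proposition3p4 G n≥1 k g k≥1 ((S , S-dom , refl) , _) =
    ≤-trans (gameLength-≤ burner) (≤-reflexive (suc-roundsNeeded-burner ∣S∣>0))
  , ≤-trans (gameLength-≤ staller) (≤-reflexive (suc-roundsNeeded-staller ∣S∣>0))
  where
  open Strategy G k k≥1 S S-dom
  ∣S∣>0 : 0 < ∣ S ∣
  ∣S∣>0 = ∈⇒∣∣-positive (proj₁ (proj₂ (S-dom (fromℕ< n≥1))))
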